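{- Let $A$ be an fMV-algebra whose internal product $\cdot$ is commutative, and let $I$ be a $\cdot$-ideal of $A$. Then $\sqrt{I}=\{x\in A\mid x^n\in I\text{ for some }n\in\mathbb N\}$ is a $\cdot$-ideal of $A$.
   Context: An fMV-algebra is a structure $(A,\oplus,\cdot,{}^*,\{\alpha\}_{\alpha\in[0,1]},0)$ where $(A,\oplus,{}^*,0)$ is an MV-algebra (with $1=0^*$, $x\odot y=(x^*\oplus y^*)^*$, $x\le y$ iff $x\odot y^*=0$, a lattice order with $x\wedge y=x\odot(x^*\oplus y)$), $\cdot$ is an associative binary operation and $x\mapsto\alpha x$ are unary operations satisfying: $z\cdot(x\odot(x\wedge y)^*)=(z\cdot x)\odot(z\cdot(x\wedge y))^*$, $(x\odot(x\wedge y)^*)\cdot z=(x\cdot z)\odot((x\wedge y)\cdot z)^*$, $x\wedge y=0\Rightarrow(x\cdot z)\wedge y=(z\cdot x)\wedge y=0$, $\alpha(x\odot y^*)=(\alpha x)\odot(\alpha y)^*$, $\max(0,\alpha-\beta)x=(\alpha x)\odot(\beta x)^*$, $\alpha(\beta x)=(\alpha\beta)x$, $1x=x$, $\alpha(x\cdot y)=(\alpha x)\cdot y=x\cdot(\alpha y)$. An ideal of $A$ is a nonempty subset $I$ with $x\oplus y\in I$ for $x,y\in I$ and $x\in I$ whenever $x\le y\in I$. A $\cdot$-ideal is an ideal $I$ such that $x\cdot y\in I$ and $y\cdot x\in I$ for all $x\in I$, $y\in A$. $x^n$ denotes the $n$-fold product $x\cdot\ldots\cdot x$ ($n\ge1$).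 -}

module Defs where

open import Level using (Level; _⊔_; suc)
open import Data.Nat using (ℕ; zero) renaming (suc to sucℕ)
open import Data.Product using (Σ; ∃; _×_)
open import Relation.Binary.PropositionalEquality using (_≡_)

-- The paper uses the real unit interval [0,1] with real
-- multiplication, the constant 1 and truncated subtraction max(0, α - β).
-- agda-stdlib has no real numbers, so we abstract over a carrier of
-- scalars equipped with exactly these three operations.
record ScalarDomain (s : Level) : Set (suc s) where
  field
    Scalar : Set s
    _*ₛ_   : Scalar → Scalar → Scalar
    _⊖ₛ_   : Scalar → Scalar → Scalar
    1ₛ     : Scalar

record FMVAlgebra {s : Level} (K : ScalarDomain s) (a : Level) : Set (suc (s ⊔ a)) where
  open ScalarDomain K
  infixl 6 _⊕_
  infixl 7 _·_
  field
    Carrier : Set a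
    _⊕_     : Carrier → Carrier → Carrier
    _·_     : Carrier → Carrier → Carrier
    _*      : Carrier → Carrier
    _•_     : Scalar → Carrier → Carrier
    0#      : Carrier

  1# : Carrier
  1# = 0# *

  _⊙_ : Carrier → Carrier → Carrier
  x ⊙ y = ((x *) ⊕ (y *)) *

  _∧_ : Carrier → Carrier → Carrier
  x ∧ y = x ⊙ ((x *) ⊕ y)

  _≤_ : Carrier → Carrier → Set a
  x ≤ y = x ⊙ (y *) ≡ 0#

  field
    ⊕-assoc : ∀ x y z → (x ⊕ y) ⊕ z ≡ x ⊕ (y ⊕ z)
    ⊕-comm  : ∀ x y → x ⊕ y ≡ y ⊕ x
    ⊕-identityʳ : ∀ x → x ⊕ 0# ≡ x
    *-involutive : ∀ x → (x *) * ≡ x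
    ⊕-absorb : ∀ x → x ⊕ 1# ≡ 1#
    łukasiewicz : ∀ x y → ((x *) ⊕ y) * ⊕ y ≡ ((y *) ⊕ x) * ⊕ x
    ·-assoc : ∀ x y z → (x · y) · z ≡ x · (y · z)
    ·-distribˡ : ∀ x y z → z · (x ⊙ ((x ∧ y) *)) ≡ (z · x) ⊙ ((z · (x ∧ y)) *)
    ·-distribʳ : ∀ x y z → (x ⊙ ((x ∧ y) *)) · z ≡ (x · z) ⊙ (((x ∧ y) · z) *)
    ·-orth : ∀ x y z → x ∧ y ≡ 0# → ((x · z) ∧ y ≡ 0#) × ((z · x) ∧ y ≡ 0#)
    •-⊙ : ∀ α x y → α • (x ⊙ (y *)) ≡ (α • x) ⊙ ((α • y) *)
    •-⊖ : ∀ α β x → (α ⊖ₛ β) • x ≡ (α • x) ⊙ ((β • x) *)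
    •-assoc : ∀ α β x → α • (β • x) ≡ (α *ₛ β) • x
    •-identity : ∀ x → 1ₛ • x ≡ x
    •-·ˡ : ∀ α x y → α • (x · y) ≡ (α • x) · y
    •-·ʳ : ∀ α x y → α • (x · y) ≡ x · (α • y)

module _ {s a : Level} {K : ScalarDomain s} (A : FMVAlgebra K a) where
  open FMVAlgebra A

  _^[1+_] : Carrier → ℕ → Carrier
  x ^[1+ zero ]   = x
  x ^[1+ sucℕ n ] = x · (x ^[1+ n ])

  ·-Commutative : Set a
  ·-Commutative = ∀ x y → x · y ≡ y · x

  record IsIdeal {ℓ : Level} (I : Carrier → Set ℓ) : Set (a ⊔ ℓ) where
    field
      nonempty : ∃ λ x → I x
      ⊕-closed : ∀ {x y} → I x → I y → I (x ⊕ y)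
      ↓-closed : ∀ {x y} → x ≤ y → I y → I x

  record Is·Ideal {ℓ : Level} (I : Carrier → Set ℓ) : Set (a ⊔ ℓ) where
    field
      isIdeal : IsIdeal I
      ·-closedʳ : ∀ {x} y → I x → I (x · y)
      ·-closedˡ : ∀ {x} y → I x → I (y · x)

  -- radical: x^n ∈ I for some n ≥ 1 (written n = m + 1)
  √ : {ℓ : Level} → (Carrier → Set ℓ) → Carrier → Set ℓ
  √ I x = Σ ℕ λ m → I (x ^[1+ m ])

-- Powers of a sum cannot be expanded binomially in an
-- MV-algebra, so instead of computing (x ⊕ y)^n we argue by induction
-- over a family of ideal-like sets.  Call J a preideal if it is a
-- down-set, closed under ⊕ and under multiplication on the right (a
-- possibly empty ·-ideal).  The key observation is that preideals are
-- stable under the colon construction (J ∶ w) = { t | w · t ∈ J }; this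
-- rests on two order facts valid in every fMV-algebra:
--   * left multiplication is monotone:  x ≤ y → (z · x) ≤ (z · y),
--   * it is subadditive:                (z · (x ⊕ y)) ≤ (z · x ⊕ z · y),
-- both consequences of the distributivity of · over truncated difference.
-- Replacing J by a colon absorbs one factor of a power, so the induction
-- hypotheses stay in the same general form.

module Submission where

open import Defs hiding (_^[1+_])
import Defs
open import Level using (Level; _⊔_)
open import Data.Nat using (ℕ; zero; suc; _+_)
open import Data.Nat.Properties using (+-comm; suc-injective)
open import Data.Product using (_,_; proj₁; proj₂)
open import Algebra.Bundles using (CommutativeSemigroup)
import Algebra.Properties.CommutativeSemigroup as CommSemigroupProperties
open import Relation.Binary.PropositionalEquality

module Order {s a : Level} {K : ScalarDomain s} (A : FMVAlgebra K a) where
  open FMVAlgebra A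
  open ≡-Reasoning

  ⊕-identityˡ : ∀ x → 0# ⊕ x ≡ x
  ⊕-identityˡ x = trans (⊕-comm 0# x) (⊕-identityʳ x)

  1*≡0 : 1# * ≡ 0#
  1*≡0 = *-involutive 0#

  ⊕-inverseˡ : ∀ x → x * ⊕ x ≡ 1#
  ⊕-inverseˡ x = begin
    x * ⊕ x            ≡⟨ cong (λ t → t * ⊕ x) (sym (⊕-identityˡ x)) ⟩
    (0# ⊕ x) * ⊕ x     ≡⟨ cong (λ t → (t ⊕ x) * ⊕ x) (sym (*-involutive 0#)) ⟩
    (1# * ⊕ x) * ⊕ x   ≡⟨ sym (łukasiewicz x 1#) ⟩
    (x * ⊕ 1#) * ⊕ 1#  ≡⟨ ⊕-absorb _ ⟩
    1#                 ∎

  *-⊕ : ∀ x y → (x ⊕ y) * ≡ (x *) ⊙ (y *)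
  *-⊕ x y = cong _* (sym (cong₂ _⊕_ (*-involutive x) (*-involutive y)))

  ⊙-comm : ∀ x y → x ⊙ y ≡ y ⊙ x
  ⊙-comm x y = cong _* (⊕-comm (x *) (y *))

  ⊙-assoc : ∀ x y z → (x ⊙ y) ⊙ z ≡ x ⊙ (y ⊙ z)
  ⊙-assoc x y z = cong _* (begin
    (x * ⊕ y *) * * ⊕ z *  ≡⟨ cong (_⊕ z *) (*-involutive _) ⟩
    (x * ⊕ y *) ⊕ z *      ≡⟨ ⊕-assoc _ _ _ ⟩
    x * ⊕ (y * ⊕ z *)      ≡⟨ cong (x * ⊕_) (sym (*-involutive _)) ⟩
    x * ⊕ (y * ⊕ z *) * *  ∎)

  ⊙-inverseʳ : ∀ x → x ⊙ (x *) ≡ 0#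
  ⊙-inverseʳ x = begin
    (x * ⊕ x * *) *  ≡⟨ cong (λ t → (x * ⊕ t) *) (*-involutive x) ⟩
    (x * ⊕ x) *      ≡⟨ cong _* (⊕-inverseˡ x) ⟩
    1# *             ≡⟨ 1*≡0 ⟩
    0#               ∎

  ⊙-zeroˡ : ∀ x → 0# ⊙ x ≡ 0#
  ⊙-zeroˡ x = begin
    0# ⊙ x        ≡⟨ ⊙-comm 0# x ⟩
    (x * ⊕ 1#) *  ≡⟨ cong _* (⊕-absorb (x *)) ⟩
    1# *          ≡⟨ 1*≡0 ⟩
    0#            ∎

  ⊙-identityʳ : ∀ x → x ⊙ 1# ≡ x
  ⊙-identityʳ x = begin
    (x * ⊕ 1# *) *  ≡⟨ cong (λ t → (x * ⊕ t) *) 1*≡0 ⟩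
    (x * ⊕ 0#) *    ≡⟨ cong _* (⊕-identityʳ (x *)) ⟩
    x * *           ≡⟨ *-involutive x ⟩
    x               ∎

  ⊙-*-⊕ : ∀ x y z → x ⊙ ((y ⊕ z) *) ≡ (x ⊙ (y *)) ⊙ (z *)
  ⊙-*-⊕ x y z = trans (cong (x ⊙_) (*-⊕ y z)) (sym (⊙-assoc x (y *) (z *)))

  -- The lattice meet is commutative; this is the Łukasiewicz axiom.
  ∧-comm : ∀ x y → x ∧ y ≡ y ∧ x
  ∧-comm x y = cong _* (begin
    x * ⊕ (x * ⊕ y) *      ≡⟨ ⊕-comm _ _ ⟩
    (x * ⊕ y) * ⊕ x *      ≡⟨ cong (λ t → (x * ⊕ t) * ⊕ x *) (sym (*-involutive y)) ⟩
    (x * ⊕ y * *) * ⊕ x *  ≡⟨ cong (λ t → t * ⊕ x *) (⊕-comm _ _) ⟩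
    (y * * ⊕ x *) * ⊕ x *  ≡⟨ łukasiewicz (y *) (x *) ⟩
    (x * * ⊕ y *) * ⊕ y *  ≡⟨ cong (λ t → t * ⊕ y *) (⊕-comm _ _) ⟩
    (y * ⊕ x * *) * ⊕ y *  ≡⟨ cong (λ t → (y * ⊕ t) * ⊕ y *) (*-involutive x) ⟩
    (y * ⊕ x) * ⊕ y *      ≡⟨ ⊕-comm _ _ ⟩
    y * ⊕ (y * ⊕ x) *      ∎)

  ≤⇒∧≡ : ∀ {x y} → x ≤ y → x ∧ y ≡ x
  ≤⇒∧≡ {x} {y} x≤y = begin
    x ⊙ (x * ⊕ y)        ≡⟨ cong (λ t → x ⊙ (x * ⊕ t)) (sym (*-involutive y)) ⟩
    x ⊙ (x * ⊕ y * *)    ≡⟨ cong (x ⊙_) (sym (*-involutive _)) ⟩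
    x ⊙ ((x ⊙ (y *)) *)  ≡⟨ cong (λ t → x ⊙ (t *)) x≤y ⟩
    x ⊙ 1#               ≡⟨ ⊙-identityʳ x ⟩
    x                    ∎

  0≤ : ∀ x → 0# ≤ x
  0≤ x = ⊙-zeroˡ (x *)

  x⊙y≤x : ∀ x y → (x ⊙ y) ≤ x
  x⊙y≤x x y = begin
    (x ⊙ y) ⊙ (x *)  ≡⟨ ⊙-assoc _ _ _ ⟩
    x ⊙ (y ⊙ (x *))  ≡⟨ cong (x ⊙_) (⊙-comm y (x *)) ⟩
    x ⊙ ((x *) ⊙ y)  ≡⟨ sym (⊙-assoc _ _ _) ⟩
    (x ⊙ (x *)) ⊙ y  ≡⟨ cong (_⊙ y) (⊙-inverseʳ x) ⟩
    0# ⊙ y           ≡⟨ ⊙-zeroˡ y ⟩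
    0#               ∎

  x≤x⊕y : ∀ x y → x ≤ (x ⊕ y)
  x≤x⊕y x y = begin
    x ⊙ ((x ⊕ y) *)      ≡⟨ ⊙-*-⊕ x x y ⟩
    (x ⊙ (x *)) ⊙ (y *)  ≡⟨ cong (_⊙ (y *)) (⊙-inverseʳ x) ⟩
    0# ⊙ (y *)           ≡⟨ ⊙-zeroˡ (y *) ⟩
    0#                   ∎

  y⊖[y⊖x]≡x : ∀ {x y} → x ≤ y → y ⊙ ((y ⊙ (x *)) *) ≡ x
  y⊖[y⊖x]≡x {x} {y} x≤y = begin
    y ⊙ ((y ⊙ (x *)) *)  ≡⟨ cong (y ⊙_) (*-involutive _) ⟩
    y ⊙ (y * ⊕ x * *)    ≡⟨ cong (λ t → y ⊙ (y * ⊕ t)) (*-involutive x) ⟩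
    y ∧ x                ≡⟨ ∧-comm y x ⟩
    x ∧ y                ≡⟨ ≤⇒∧≡ x≤y ⟩
    x                    ∎

  -- Left multiplication distributes over the truncated difference y ⊙ d*
  -- when d ≤ y; this is the product axiom once y ∧ d is simplified to d.
  ·-distribˡ-⊖ : ∀ z {y d} → d ≤ y → z · (y ⊙ (d *)) ≡ (z · y) ⊙ ((z · d) *)
  ·-distribˡ-⊖ z {y} {d} d≤y = begin
    z · (y ⊙ (d *))              ≡⟨ cong (λ t → z · (y ⊙ (t *))) (sym y∧d≡d) ⟩
    z · (y ⊙ ((y ∧ d) *))        ≡⟨ ·-distribˡ y d z ⟩
    (z · y) ⊙ ((z · (y ∧ d)) *)  ≡⟨ cong (λ t → (z · y) ⊙ ((z · t) *)) y∧d≡d ⟩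
    (z · y) ⊙ ((z · d) *)        ∎
    where
    y∧d≡d : y ∧ d ≡ d
    y∧d≡d = trans (∧-comm y d) (≤⇒∧≡ d≤y)

  -- Left multiplication is monotone: write x = y ⊙ d* with d = y ⊙ x*.
  ·-monoˡ-≤ : ∀ z {x y} → x ≤ y → (z · x) ≤ (z · y)
  ·-monoˡ-≤ z {x} {y} x≤y = begin
    (z · x) ⊙ ((z · y) *)                            ≡⟨ cong (λ t → (z · t) ⊙ ((z · y) *)) (sym (y⊖[y⊖x]≡x x≤y)) ⟩
    (z · (y ⊙ ((y ⊙ (x *)) *))) ⊙ ((z · y) *)        ≡⟨ cong (_⊙ ((z · y) *)) (·-distribˡ-⊖ z (x⊙y≤x y (x *))) ⟩
    ((z · y) ⊙ ((z · (y ⊙ (x *))) *)) ⊙ ((z · y) *)  ≡⟨ x⊙y≤x (z · y) _ ⟩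
    0#                                               ∎

  -- Left multiplication is subadditive: z · (x ⊕ y) ⊙ (z · x)* is
  -- z · ((x ⊕ y) ⊙ x*), and (x ⊕ y) ⊙ x* ≤ y.
  ·-subdistribˡ-⊕ : ∀ z x y → (z · (x ⊕ y)) ≤ (z · x ⊕ z · y)
  ·-subdistribˡ-⊕ z x y = begin
    (z · (x ⊕ y)) ⊙ ((z · x ⊕ z · y) *)          ≡⟨ ⊙-*-⊕ _ _ _ ⟩
    ((z · (x ⊕ y)) ⊙ ((z · x) *)) ⊙ ((z · y) *)  ≡⟨ cong (_⊙ ((z · y) *)) (sym (·-distribˡ-⊖ z (x≤x⊕y x y))) ⟩
    (z · ((x ⊕ y) ⊙ (x *))) ⊙ ((z · y) *)        ≡⟨ ·-monoˡ-≤ z difference≤y ⟩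
    0#                                           ∎
    where
    difference≤y : ((x ⊕ y) ⊙ (x *)) ≤ y
    difference≤y = trans (sym (⊙-*-⊕ (x ⊕ y) x y)) (⊙-inverseʳ (x ⊕ y))

  record IsPreideal {ℓ : Level} (J : Carrier → Set ℓ) : Set (a ⊔ ℓ) where
    field
      ↓-closed  : ∀ {x y} → x ≤ y → J y → J x
      ⊕-closed  : ∀ {x y} → J x → J y → J (x ⊕ y)
      ·-closedʳ : ∀ {x} y → J x → J (x · y)

  _∶_ : {ℓ : Level} → (Carrier → Set ℓ) → Carrier → Carrier → Set ℓ
  (J ∶ w) t = J (w · t)

  colon-preideal : {ℓ : Level} {J : Carrier → Set ℓ} → IsPreideal J → ∀ w → IsPreideal (J ∶ w)
  colon-preideal {J = J} P w = record
    { ↓-closed  = λ x≤y → ↓-closed (·-monoˡ-≤ w x≤y)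
    ; ⊕-closed  = λ {x} {y} wx wy → ↓-closed (·-subdistribˡ-⊕ w x y) (⊕-closed wx wy)
    ; ·-closedʳ = λ {x} y wx → subst J (·-assoc w x y) (·-closedʳ y wx)
    }
    where open IsPreideal P

module Commutative {s a : Level} {K : ScalarDomain s} (A : FMVAlgebra K a) (comm : ·-Commutative A) where
  open FMVAlgebra A
  open Order A public

  _^[1+_] : Carrier → ℕ → Carrier
  _^[1+_] = Defs._^[1+_] A

  ·-commutativeSemigroup : CommutativeSemigroup a a
  ·-commutativeSemigroup = record
    { _≈_ = _≡_
    ; _∙_ = _·_
    ; isCommutativeSemigroup = record
      { isSemigroup = record
        { isMagma = record { isEquivalence = isEquivalence ; ∙-cong = cong₂ _·_ }
        ; assoc = ·-assoc
        }
      ; comm = comm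
      }
    }

  open CommSemigroupProperties ·-commutativeSemigroup using (interchange)

  ^-distrib-· : ∀ x y m → (x · y) ^[1+ m ] ≡ x ^[1+ m ] · y ^[1+ m ]
  ^-distrib-· x y zero    = refl
  ^-distrib-· x y (suc m) = trans (cong ((x · y) ·_) (^-distrib-· x y m)) (interchange x y _ _)

  ·-monoʳ-≤ : ∀ z {x y} → x ≤ y → (x · z) ≤ (y · z)
  ·-monoʳ-≤ z {x} {y} x≤y = subst₂ _≤_ (comm z x) (comm z y) (·-monoˡ-≤ z x≤y)

  ·-subdistribʳ-⊕ : ∀ z x y → ((x ⊕ y) · z) ≤ (x · z ⊕ y · z)
  ·-subdistribʳ-⊕ z x y =
    subst₂ _≤_ (comm z (x ⊕ y)) (cong₂ _⊕_ (comm z x) (comm z y)) (·-subdistribˡ-⊕ z x y)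

  module _ {ℓ : Level} where

    ·-closedˡ : {J : Carrier → Set ℓ} → IsPreideal J → ∀ {x} y → J x → J (y · x)
    ·-closedˡ {J} P {x} y jx = subst J (comm x y) (IsPreideal.·-closedʳ P y jx)

    -- Preideals contain the powers of smaller elements: peeling one
    -- factor x off x^(m+2) moves the claim into the colon (J ∶ x).
    pow-↓-closed : ∀ m {J : Carrier → Set ℓ} → IsPreideal J → ∀ {x y} → x ≤ y →
                   J (y ^[1+ m ]) → J (x ^[1+ m ])
    pow-↓-closed zero    P x≤y jy = IsPreideal.↓-closed P x≤y jy
    pow-↓-closed (suc m) P {x} {y} x≤y jy =
      pow-↓-closed m (colon-preideal P x) x≤y
        (IsPreideal.↓-closed P (·-monoʳ-≤ (y ^[1+ m ]) x≤y) jy)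

    PowSum : ℕ → Set (a ⊔ Level.suc ℓ)
    PowSum n = ∀ {J : Carrier → Set ℓ} → IsPreideal J → ∀ {x y} m k → m + k ≡ n →
               J (x ^[1+ m ]) → J (y ^[1+ k ]) → J ((x ⊕ y) ^[1+ n ])

    -- One summand of the inductive step: x · (x ⊕ y)^(n+1) ∈ J, either
    -- directly (m = 0) or by the hypothesis for n applied to (J ∶ x).
    pow-sum-summand : ∀ {n} → PowSum n → ∀ {J : Carrier → Set ℓ} → IsPreideal J → ∀ {x y} m k →
                      m + k ≡ suc n → J (x ^[1+ m ]) → J (y ^[1+ k ]) → J (x · (x ⊕ y) ^[1+ n ])
    pow-sum-summand _   P zero    k _  jx _  = IsPreideal.·-closedʳ P _ jx
    pow-sum-summand hyp P {x} (suc m) k eq jx jy =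
      hyp (colon-preideal P x) m k (suc-injective eq) jx (·-closedˡ P x jy)

    -- (x ⊕ y)^(n+2) = (x ⊕ y) · (x ⊕ y)^(n+1) lies below the sum of the two
    -- summands, the second obtained from the first by exchanging x and y.
    pow-sum : ∀ n → PowSum n
    pow-sum zero    P zero zero refl jx jy = IsPreideal.⊕-closed P jx jy
    pow-sum (suc n) {J} P {x} {y} m k eq jx jy =
      IsPreideal.↓-closed P (·-subdistribʳ-⊕ w x y) (IsPreideal.⊕-closed P x·w y·w)
      where
      w : Carrier
      w = (x ⊕ y) ^[1+ n ]
      x·w : J (x · w)
      x·w = pow-sum-summand (pow-sum n) P m k eq jx jy
      y·w : J (y · w)
      y·w = subst (λ t → J (y · t ^[1+ n ])) (⊕-comm y x)
              (pow-sum-summand (pow-sum n) P k m (trans (+-comm k m) eq) jy jx)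

proposition2p15 : {s a ℓ : Level} {K : ScalarDomain s} (A : FMVAlgebra K a) →
    ·-Commutative A →
    (I : FMVAlgebra.Carrier A → Set ℓ) → Is·Ideal A I →
    Is·Ideal A (√ A I)
-- 0 ∈ √I because I is a nonempty down-set; ⊕ and ≤ are handled by the
-- preideal lemmas; products by distributing powers and commutativity.
proposition2p15 A comm I I-ideal = record
  { isIdeal = record
    { nonempty = 0# , zero , ↓-closed (0≤ (proj₁ nonempty)) (proj₂ nonempty)
    ; ⊕-closed = λ { (m , jx) (k , jy) → m + k , pow-sum (m + k) preideal m k refl jx jy }
    ; ↓-closed = λ { x≤y (m , jy) → m , pow-↓-closed m preideal x≤y jy }
    }
  ; ·-closedʳ = λ { {x} y (m , jx) → m , ·-closedʳ-pow x y m jx }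
  ; ·-closedˡ = λ { {x} y (m , jx) → m , subst (λ t → I (t ^[1+ m ])) (comm x y) (·-closedʳ-pow x y m jx) }
  }
  where
  open FMVAlgebra A using (0#; _·_)
  open Commutative A comm
  open Is·Ideal I-ideal using (isIdeal; ·-closedʳ)
  open IsIdeal isIdeal using (nonempty; ↓-closed; ⊕-closed)

  preideal : IsPreideal I
  preideal = record { ↓-closed = ↓-closed ; ⊕-closed = ⊕-closed ; ·-closedʳ = ·-closedʳ }

  ·-closedʳ-pow : ∀ x y m → I (x ^[1+ m ]) → I ((x · y) ^[1+ m ])
  ·-closedʳ-pow x y m jx = subst I (sym (^-distrib-· x y m)) (·-closedʳ (y ^[1+ m ]) jx)
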